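{- Let $r=1\mod{4}$, $3\leq r\leq n$. For any $1 \le k < n$, suppose that $\mathbb{Z}_k$ is a $1$-Gray code for $\mathcal{Z}_k$ with $\mathrm{first}(\mathbb{Z}_k)=0(001)^\star$ and $\mathrm{last}(\mathbb{Z}_k)=(001)^\star$. ($i$) If $r\neq n-1$, then there is a $1$-Gray code $\Delta^r_n$ for $\mathcal{D}^r_n\cup \mathcal{D}^{r-1}_n$ such that $\mathrm{first}(\Delta^r_n)=0^{r-2}1(001)^\star$ and $\mathrm{last}(\Delta^r_n)=0^{r-1}1(001)^\star$. ($ii$) If $r=n-1$, then there is a $1$-Gray code $\Delta^{n-1}_n$ for $\mathcal{D}^{n}_n\cup \mathcal{D}^{n-1}_n\cup \mathcal{D}^{n-2}_n$ such that $\mathrm{first}(\Delta^{n-1}_n)=0^{n-3}100$ and $\mathrm{last}(\Delta^{n-1}_n)=0^{n-1}1$.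
   Context: A binary word is $1$-decreasing if each of its maximal factors of the form $0^a1^b$ with $a>0$ satisfies $a>b$. $\mathcal{Z}_n$ denotes the set of $1$-decreasing words of length $n$ that start with $0$ (with $\mathcal{Z}_0$ consisting of the empty word). For $3\le r\le n$, $\mathcal{D}_n^r=\bigcup_{j=1}^{\lfloor\frac{r-1}{2}\rfloor} 0^{r-j}1^{j}\cdot\mathcal{Z}_{n-r}$, where $w\cdot\mathcal{A}$ prepends $w$ to each word of $\mathcal{A}$; thus $\mathcal{Z}_n=\{0^n\}\cup\bigcup_{r=3}^n\mathcal{D}_n^r$. A $1$-Gray code for a set of words is an ordered list of all its words such that any two consecutive words have Hamming distance at most one. $\mathrm{first}(\mathbb{L})$ and $\mathrm{last}(\mathbb{L})$ denote the first and last elements of a list $\mathbb{L}$. For a word $v$, $v^\star$ means $v$ repeated as many times as needed to reach the (contextually understood) total length, trimming extra symbols at the end. -}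

module Defs where

open import Data.Bool using (Bool; true; false; if_then_else_)
open import Data.Bool.Properties using () renaming (_≟_ to _≟ᵇ_)
open import Data.Nat using (ℕ; zero; suc; _+_; _∸_; _≤_; _<_; _/_)
open import Data.List using (List; []; _∷_; _++_; replicate; take; concat; length; head; last)
open import Data.List.Membership.Propositional using (_∈_)
open import Data.List.Relation.Unary.Unique.Propositional using (Unique)
open import Data.List.Relation.Unary.Linked using (Linked)
open import Data.Product using (Σ; ∃; _×_; _,_)
open import Data.Sum using (_⊎_)
open import Data.Maybe using (Maybe; just)
open import Relation.Binary.PropositionalEquality using (_≡_; _≢_)
open import Relation.Nullary using (yes; no)

-- Binary words: false = 0, true = 1.
Word : Set
Word = List Bool

0^ : ℕ → Word
0^ a = replicate a false

1^ : ℕ → Word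
1^ b = replicate b true

-- Maximality of an occurrence  w = u ++ 0^a 1^b ++ v  of a factor of form 0^a1^b:
-- it cannot be extended to the left (u does not end with 0) ...
LeftMax : Word → Set
LeftMax u = ∀ u' → u ≢ u' ++ (false ∷ [])

-- ... nor to the right: v is empty, or v starts with 0 and b > 0.
-- (If v starts with 1, or b = 0 and v starts with 0, the factor extends.)
RightMax : ℕ → Word → Set
RightMax b v = (v ≡ []) ⊎ (Σ Word λ v' → (v ≡ false ∷ v') × (0 < b))

OneDecreasing : Word → Set
OneDecreasing w =
  ∀ (u : Word) (a b : ℕ) (v : Word) →
  w ≡ u ++ 0^ a ++ 1^ b ++ v → 0 < a → LeftMax u → RightMax b v → b < a

StartsWith0 : Word → Set
StartsWith0 w = Σ Word λ w' → w ≡ false ∷ w'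

InZ : ℕ → Word → Set
InZ n w = length w ≡ n × OneDecreasing w × ((w ≡ []) ⊎ StartsWith0 w)

InD : ℕ → ℕ → Word → Set
InD n r w = Σ ℕ λ j → (1 ≤ j) × (j ≤ (r ∸ 1) / 2) ×
  (Σ Word λ z → InZ (n ∸ r) z × (w ≡ 0^ (r ∸ j) ++ 1^ j ++ z))

-- Hamming distance (words compared are always of equal length here;
-- leftover symbols of a longer word count as differences)
hamming : Word → Word → ℕ
hamming [] ys = length ys
hamming (x ∷ xs) [] = length (x ∷ xs)
hamming (x ∷ xs) (y ∷ ys) with x ≟ᵇ y
... | yes _ = hamming xs ys
... | no _ = suc (hamming xs ys)

Close : Word → Word → Set
Close x y = hamming x y ≤ 1

IsGrayCode : (Word → Set) → List Word → Set
IsGrayCode S L =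
  (∀ w → w ∈ L → S w) × (∀ w → S w → w ∈ L) × Unique L × Linked Close L

-- v^⋆ trimmed to length m
star : Word → ℕ → Word
star v m = take m (concat (replicate m v))

w001 : Word
w001 = false ∷ false ∷ true ∷ []

ZCodesBelow : ℕ → Set
ZCodesBelow n = ∀ k → 1 ≤ k → k < n →
  Σ (List Word) λ Z → IsGrayCode (InZ k) Z ×
    (head Z ≡ just (false ∷ star w001 (k ∸ 1))) × (last Z ≡ just (star w001 k))

-- Write R = r − 1 = 4(u + 1). The sets 𝒟ⁿ_{R+1} and 𝒟ⁿ_R are unions of layers
-- 0^{M−j}1^j · 𝒵_k (M = R + 1 resp. R), each of which inherits a Gray code from 𝒵_k.
-- Within one union, traverse the layers j = 1, 2, 3, … alternately backwards and
-- forwards: consecutive layers then meet at words with equal tails, which differ in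
-- one bit. As 𝒟ⁿ_R has an odd and 𝒟ⁿ_{R+1} an even number of layers, this snake
-- through 𝒟ⁿ_R ends at 0^{2u+3}1^{2u+1}0·last(𝒵_{n−R−1}), one bit away from where
-- the reversed snake through 𝒟ⁿ_{R+1} begins. For n = r + 1 every layer is a single
-- word, and the layers of 𝒟ⁿ_n and 𝒟ⁿ_{n−1} are interleaved instead.
module Submission where

open import Defs
open import Data.Bool using (Bool; true; false)
open import Data.Bool.Properties using () renaming (_≟_ to _≟ᵇ_)
open import Data.Nat using (ℕ; zero; suc; _+_; _*_; _∸_; _≤_; _<_; _%_; _/_; z≤n; s≤s)
open import Data.Nat.Properties
  using (≤-refl; ≤-trans; <⇒≤; ≤-pred; m≤n⇒m≤1+n; m≤n⇒m<n∨m≡n; n≮n; n≮0; +-∸-assoc;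
         ∸-cancelʳ-≡; ∸-monoʳ-<; +-comm; n∸n≡0; m+n∸n≡m; m≢1+n+m)
open import Data.Nat.DivMod using (m/n≡1+[m∸n]/n; m≡m%n+[m/n]*n)
open import Data.List using (List; []; _∷_; _++_; head; last; map; reverse; replicate)
open import Data.List.Properties
  using (++-cancelˡ; ∷-injectiveʳ; unfold-reverse; reverse-involutive; head-map; last-map)
open import Data.List.Membership.Propositional using (_∈_)
open import Data.List.Membership.Propositional.Properties
  using (∈-map⁺; ∈-map⁻; ∈-++⁺ˡ; ∈-++⁺ʳ; ∈-++⁻)
open import Data.List.Relation.Unary.Any using (here)
import Data.List.Relation.Unary.Any.Properties as Any
open import Data.List.Relation.Unary.Unique.Propositional using (Unique)
import Data.List.Relation.Unary.Unique.Propositional.Properties as Unique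
open import Data.List.Relation.Unary.All using ([])
open import Data.List.Relation.Unary.AllPairs using ([]; _∷_)
open import Data.List.Relation.Unary.Linked using (Linked; []; [-]; _∷_)
import Data.List.Relation.Unary.Linked as Linked
import Data.List.Relation.Unary.Linked.Properties as Linked
open import Relation.Binary.PropositionalEquality
  using (_≡_; _≢_; refl; sym; trans; cong; subst; subst₂; setoid)
open import Data.List.Relation.Binary.Permutation.Setoid (setoid Word) using (↭-sym)
open import Data.List.Relation.Binary.Permutation.Setoid.Properties (setoid Word)
  using (↭-reverse; Unique-resp-↭)
open import Data.Maybe using (just)
import Data.Maybe as Maybe
open import Data.Maybe.Relation.Binary.Connected using (Connected; just)
open import Data.Product using (Σ; _×_; _,_; proj₁; proj₂; map₁)
open import Data.Sum using (_⊎_; inj₁; inj₂; swap; [_,_]′)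
import Data.Sum as Sum
open import Data.Empty using (⊥-elim)
open import Function using (_∘_)
open import Relation.Nullary using (¬_; yes; no)
open import Relation.Unary using (_⊆_; _≐_; _∪_) renaming (_⊥_ to Disjoint)
open import Relation.Unary.Properties using (≐-sym)
open import Relation.Binary.Core using (Rel)
open import Relation.Binary.Definitions using (Symmetric)

hamming-refl : ∀ x → hamming x x ≡ 0
hamming-refl [] = refl
hamming-refl (c ∷ x) with c ≟ᵇ c
... | yes _ = hamming-refl x
... | no c≢c = ⊥-elim (c≢c refl)

hamming-sym : ∀ x y → hamming x y ≡ hamming y x
hamming-sym [] [] = refl
hamming-sym [] (_ ∷ _) = refl
hamming-sym (_ ∷ _) [] = refl
hamming-sym (c ∷ x) (d ∷ y) with c ≟ᵇ d | d ≟ᵇ c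
... | yes _   | yes _   = hamming-sym x y
... | no _    | no _    = cong suc (hamming-sym x y)
... | yes c≡d | no d≢c  = ⊥-elim (d≢c (sym c≡d))
... | no c≢d  | yes d≡c = ⊥-elim (c≢d (sym d≡c))

hamming-++ˡ : ∀ p x y → hamming (p ++ x) (p ++ y) ≡ hamming x y
hamming-++ˡ [] x y = refl
hamming-++ˡ (c ∷ p) x y with c ≟ᵇ c
... | yes _ = hamming-++ˡ p x y
... | no c≢c = ⊥-elim (c≢c refl)

close-sym : Symmetric Close
close-sym {x} {y} = subst (_≤ 1) (hamming-sym x y)

close-++ˡ : ∀ p {x y} → Close x y → Close (p ++ x) (p ++ y)
close-++ˡ p {x} {y} = subst (_≤ 1) (sym (hamming-++ˡ p x y))

close-flip : ∀ p s → Close (p ++ false ∷ s) (p ++ true ∷ s)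
close-flip p s = close-++ˡ p (subst (λ d → suc d ≤ 1) (sym (hamming-refl s)) ≤-refl)

record GrayCode (S : Word → Set) (a b : Word) : Set where
  field
    list     : List Word
    sound    : ∀ {w} → w ∈ list → S w
    complete : ∀ {w} → S w → w ∈ list
    unique   : Unique list
    linked   : Linked Close list
    starts   : head list ≡ just a
    ends     : last list ≡ just b
open GrayCode

fromIsGrayCode : ∀ {S L a b} → IsGrayCode S L → head L ≡ just a → last L ≡ just b →
  GrayCode S a b
fromIsGrayCode {L = L} (s , c , u , l) h t =
  record { list = L ; sound = s _ ; complete = c _ ; unique = u ; linked = l
         ; starts = h ; ends = t }

toIsGrayCode : ∀ {S a b} → GrayCode S a b →
  Σ (List Word) λ Δ → IsGrayCode S Δ × (head Δ ≡ just a) × (last Δ ≡ just b)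
toIsGrayCode G =
  list G , ((λ _ → sound G) , (λ _ → complete G) , unique G , linked G) , starts G , ends G

GrayCode-≐ : ∀ {S T a b} → S ≐ T → GrayCode S a b → GrayCode T a b
GrayCode-≐ (S⊆T , T⊆S) G = record
  { list = list G ; sound = S⊆T ∘ sound G ; complete = complete G ∘ T⊆S
  ; unique = unique G ; linked = linked G ; starts = starts G ; ends = ends G }

∪-comm : ∀ {S T : Word → Set} → S ∪ T ≐ T ∪ S
∪-comm = swap , swap

∪-reverse₃ : ∀ {S T U : Word → Set} → S ∪ (T ∪ U) ≐ U ∪ (T ∪ S)
∪-reverse₃ = [ inj₂ ∘ inj₂ , [ inj₂ ∘ inj₁ , inj₁ ]′ ]′ , [ inj₂ ∘ inj₂ , [ inj₂ ∘ inj₁ , inj₁ ]′ ]′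

∪-cong : ∀ {S S′ T T′ : Word → Set} → S ≐ S′ → T ≐ T′ → S ∪ T ≐ S′ ∪ T′
∪-cong (S⊆S′ , S′⊆S) (T⊆T′ , T′⊆T) = Sum.map S⊆S′ T⊆T′ , Sum.map S′⊆S T′⊆T

Disjoint-∪ʳ : ∀ {S T U : Word → Set} → Disjoint S T → Disjoint S U → Disjoint S (T ∪ U)
Disjoint-∪ʳ S#T S#U (s , inj₁ t) = S#T (s , t)
Disjoint-∪ʳ S#T S#U (s , inj₂ u) = S#U (s , u)

head-++ : ∀ {A : Set} {x : A} xs ys → head xs ≡ just x → head (xs ++ ys) ≡ just x
head-++ (_ ∷ _) ys h = h

last-++ : ∀ {A : Set} {y : A} xs ys → last ys ≡ just y → last (xs ++ ys) ≡ just y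
last-++ [] ys t = t
last-++ (x ∷ []) (_ ∷ _) t = t
last-++ (x ∷ x′ ∷ xs) (_ ∷ _) t = last-++ (x′ ∷ xs) (_ ∷ _) t

GrayCode-++ : ∀ {S T a b c d} → GrayCode S a b → GrayCode T c d → Close b c →
  Disjoint S T → GrayCode (S ∪ T) a d
GrayCode-++ G H b~c S#T = record
  { list = list G ++ list H
  ; sound = Sum.map (sound G) (sound H) ∘ ∈-++⁻ (list G)
  ; complete = [ ∈-++⁺ˡ ∘ complete G , ∈-++⁺ʳ (list G) ∘ complete H ]′
  ; unique = Unique.++⁺ (unique G) (unique H) (λ (p , q) → S#T (sound G p , sound H q))
  ; linked = Linked.++⁺ (linked G)
      (subst₂ (Connected Close) (sym (ends G)) (sym (starts H)) (just b~c)) (linked H)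
  ; starts = head-++ (list G) (list H) (starts G)
  ; ends = last-++ (list G) (list H) (ends H) }

module _ {A : Set} where

  last-reverse : ∀ (xs : List A) → last (reverse xs) ≡ head xs
  last-reverse [] = refl
  last-reverse (x ∷ xs) = trans (cong last (unfold-reverse x xs)) (last-++ (reverse xs) _ refl)

  head-reverse : ∀ (xs : List A) → head (reverse xs) ≡ last xs
  head-reverse xs = trans (sym (last-reverse (reverse xs))) (cong last (reverse-involutive xs))

  linked-reverse : ∀ {ℓ} {R : Rel A ℓ} → Symmetric R → ∀ {xs} → Linked R xs → Linked R (reverse xs)
  linked-reverse R-sym [] = []
  linked-reverse R-sym [-] = [-]
  linked-reverse {R = R} R-sym {x ∷ y ∷ xs} (Rxy ∷ Ryxs) =
    subst (Linked R) (sym (unfold-reverse x (y ∷ xs)))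
      (Linked.++⁺ (linked-reverse R-sym Ryxs)
        (subst (λ m → Connected R m (just x)) (sym (last-reverse (y ∷ xs))) (just (R-sym Rxy)))
        [-])

GrayCode-reverse : ∀ {S a b} → GrayCode S a b → GrayCode S b a
GrayCode-reverse G = record
  { list = reverse (list G)
  ; sound = sound G ∘ Any.reverse⁻
  ; complete = Any.reverse⁺ ∘ complete G
  ; unique = Unique-resp-↭ (↭-sym (↭-reverse (list G))) (unique G)
  ; linked = linked-reverse {R = Close} (λ {x} {y} → close-sym {x} {y}) (linked G)
  ; starts = trans (head-reverse (list G)) (ends G)
  ; ends = trans (last-reverse (list G)) (starts G) }

Image : (Word → Word) → (Word → Set) → Word → Set
Image f S w = Σ Word λ z → S z × (w ≡ f z)

GrayCode-map : ∀ {S a b} (f : Word → Word) → (∀ {x y} → f x ≡ f y → x ≡ y) →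
  (∀ x y → hamming (f x) (f y) ≡ hamming x y) →
  GrayCode S a b → GrayCode (Image f S) (f a) (f b)
GrayCode-map f f-inj f-isometry G = record
  { list = map f (list G)
  ; sound = λ w∈ → let (z , z∈ , eq) = ∈-map⁻ f w∈ in z , sound G z∈ , eq
  ; complete = λ { (z , Sz , refl) → ∈-map⁺ f (complete G Sz) }
  ; unique = Unique.map⁺ f-inj (unique G)
  ; linked = Linked.map⁺ (Linked.map (λ {x} {y} → subst (_≤ 1) (sym (f-isometry x y))) (linked G))
  ; starts = trans (head-map {f = f} (list G)) (cong (Maybe.map f) (starts G))
  ; ends = trans (last-map f (list G)) (cong (Maybe.map f) (ends G)) }

-- Layers 0^{M−j}1^j · 𝒵_k

lead : ℕ → ℕ → Word → Word
lead a b z = 0^ a ++ 1^ b ++ z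

Layer : ℕ → ℕ → ℕ → Word → Set
Layer M k j = Image (lead (M ∸ j) j) (InZ k)

Range : (ℕ → Word → Set) → ℕ → Word → Set
Range F N w = Σ ℕ λ j → (1 ≤ j) × (j ≤ N) × F j w

GrayCode-lead : ∀ a b {S f l} → GrayCode S f l →
  GrayCode (Image (lead a b) S) (lead a b f) (lead a b l)
GrayCode-lead a b = GrayCode-map (lead a b)
  (λ eq → ++-cancelˡ (1^ b) _ _ (++-cancelˡ (0^ a) _ _ eq))
  (λ x y → trans (hamming-++ˡ (0^ a) _ _) (hamming-++ˡ (1^ b) x y))

replicate-suc-++ : ∀ n (c : Bool) y → replicate (suc n) c ++ y ≡ replicate n c ++ c ∷ y
replicate-suc-++ zero c y = refl
replicate-suc-++ (suc n) c y = cong (c ∷_) (replicate-suc-++ n c y)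

close-shift : ∀ a b x → Close (lead (suc a) b x) (lead a (suc b) x)
close-shift a b x =
  subst (λ w → Close w (lead a (suc b) x)) (sym (replicate-suc-++ a false (1^ b ++ x)))
    (close-flip (0^ a) (1^ b ++ x))

close-absorb : ∀ a b x → Close (lead a b (false ∷ x)) (lead a (suc b) x)
close-absorb a b x = close-++ˡ (0^ a)
  (subst (Close (1^ b ++ false ∷ x)) (sym (replicate-suc-++ b true x)) (close-flip (1^ b) x))

∸≡suc∸suc : ∀ {m n} → m < n → n ∸ m ≡ suc (n ∸ suc m)
∸≡suc∸suc {m} {suc n} (s≤s m≤n) = +-∸-assoc 1 m≤n

close-layer-step : ∀ {M} j x → j < M → Close (lead (M ∸ j) j x) (lead (M ∸ suc j) (suc j) x)
close-layer-step {M} j x j<M =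
  subst (λ a → Close (lead a j x) (lead (M ∸ suc j) (suc j) x)) (sym (∸≡suc∸suc j<M))
    (close-shift (M ∸ suc j) j x)

NoLeading1 : Word → Set
NoLeading1 z = (z ≡ []) ⊎ StartsWith0 z

¬NoLeading1-true : ∀ {z} → ¬ NoLeading1 (true ∷ z)
¬NoLeading1-true (inj₁ ())
¬NoLeading1-true (inj₂ (_ , ()))

0^-cancel : ∀ a a′ {x y} → 0^ a ++ true ∷ x ≡ 0^ a′ ++ true ∷ y → a ≡ a′ × x ≡ y
0^-cancel zero zero refl = refl , refl
0^-cancel (suc a) (suc a′) eq = map₁ (cong suc) (0^-cancel a a′ (∷-injectiveʳ eq))

1^-cancel : ∀ b b′ {x y} → NoLeading1 x → NoLeading1 y → 1^ b ++ x ≡ 1^ b′ ++ y → b ≡ b′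
1^-cancel zero zero _ _ _ = refl
1^-cancel zero (suc b′) x₀ _ refl = ⊥-elim (¬NoLeading1-true x₀)
1^-cancel (suc b) zero _ y₀ refl = ⊥-elim (¬NoLeading1-true y₀)
1^-cancel (suc b) (suc b′) x₀ y₀ eq = cong suc (1^-cancel b b′ x₀ y₀ (∷-injectiveʳ eq))

-- Words of 𝒵_k never start with 1, so a nonempty block of ones is read off uniquely.
Layer-index : ∀ {M M′ k k′ i j w} → Layer M k (suc i) w → Layer M′ k′ (suc j) w →
  (M ∸ suc i ≡ M′ ∸ suc j) × (i ≡ j)
Layer-index {M} {M′} {i = i} {j} (z , (_ , _ , z₀) , refl) (z′ , (_ , _ , z′₀) , eq)
  with 0^-cancel (M ∸ suc i) (M′ ∸ suc j) eq
... | a≡a′ , rest = a≡a′ , 1^-cancel i j z₀ z′₀ rest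

Layer-disjoint : ∀ {M M′ k k′ i j} → M ≢ M′ → i < M → j < M′ →
  Disjoint (Layer M k (suc i)) (Layer M′ k′ (suc j))
Layer-disjoint {M} {M′} M≢M′ i<M j<M′ (p , q) with Layer-index {M} {M′} p q
... | a≡a′ , refl = M≢M′ (∸-cancelʳ-≡ i<M j<M′ a≡a′)

Range-disjoint : ∀ {M M′ k k′ N N′} → M ≢ M′ → N ≤ M → N′ ≤ M′ →
  Disjoint (Range (Layer M k) N) (Range (Layer M′ k′) N′)
Range-disjoint {M} {M′} M≢M′ N≤M N′≤M′ ((suc i , _ , i<N , p) , (suc j , _ , j<N′ , q)) =
  Layer-disjoint {M} {M′} M≢M′ (≤-trans i<N N≤M) (≤-trans j<N′ N′≤M′) (p , q)

Range-disjoint-next : ∀ {M k N} → Disjoint (Range (Layer M k) N) (Layer M k (suc N))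
Range-disjoint-next {M} {N = N} ((suc i , _ , i<N , p) , q) with Layer-index {M} {M} p q
... | _ , refl = n≮n N i<N

Range-one : ∀ {F} → Range F 1 ≐ F 1
Range-one = (λ { (suc zero , _ , _ , F1) → F1 ; (suc (suc _) , _ , s≤s () , _) })
          , (λ F1 → 1 , ≤-refl , ≤-refl , F1)

Range-zero-empty : ∀ {F w} → ¬ Range F 0 w
Range-zero-empty (suc _ , _ , () , _)

Range-suc : ∀ {F N} → Range F (suc N) ≐ Range F N ∪ F (suc N)
Range-suc {F} {N} = split , [ weaken , top ]′
  where
  split : ∀ {w} → Range F (suc N) w → (Range F N ∪ F (suc N)) w
  split (j , 1≤j , j≤1+N , Fj) with m≤n⇒m<n∨m≡n j≤1+N
  ... | inj₁ j<1+N = inj₁ (j , 1≤j , ≤-pred j<1+N , Fj)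
  ... | inj₂ refl = inj₂ Fj
  weaken : ∀ {w} → Range F N w → Range F (suc N) w
  weaken (j , 1≤j , j≤N , Fj) = j , 1≤j , m≤n⇒m≤1+n j≤N , Fj
  top : ∀ {w} → F (suc N) w → Range F (suc N) w
  top F1+N = suc N , s≤s z≤n , ≤-refl , F1+N

GrayCode-snoc : ∀ {M k N a b c d} → GrayCode (Range (Layer M k) N) a b →
  GrayCode (Layer M k (suc N)) c d → Close b c → GrayCode (Range (Layer M k) (suc N)) a d
GrayCode-snoc G B b~c = GrayCode-≐ (≐-sym Range-suc) (GrayCode-++ G B b~c Range-disjoint-next)

GrayCode-snocˡ : ∀ {M k N T a b c d} → GrayCode (Range (Layer M k) N ∪ T) a b →
  GrayCode (Layer M k (suc N)) c d → Close b c → Disjoint (Range (Layer M k) (suc N)) T →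
  GrayCode (Range (Layer M k) (suc N) ∪ T) a d
GrayCode-snocˡ {M} {k} {N} {T} G B b~c R#T = GrayCode-≐ regroup (GrayCode-++ G B b~c apart)
  where
  grow : Range (Layer M k) N ∪ Layer M k (suc N) ⊆ Range (Layer M k) (suc N)
  grow = proj₂ (Range-suc {Layer M k} {N})
  apart : Disjoint (Range (Layer M k) N ∪ T) (Layer M k (suc N))
  apart (inj₁ r , l) = Range-disjoint-next (r , l)
  apart (inj₂ t , l) = R#T (grow (inj₂ l) , t)
  regroup : (Range (Layer M k) N ∪ T) ∪ Layer M k (suc N) ≐ Range (Layer M k) (suc N) ∪ T
  regroup = [ Sum.map₁ (grow ∘ inj₁) , inj₁ ∘ grow ∘ inj₂ ]′
          , [ Sum.map₁ inj₁ ∘ proj₁ (Range-suc {Layer M k} {N}) , inj₁ ∘ inj₂ ]′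

GrayCode-snocʳ : ∀ {M k N T a b c d} → GrayCode (T ∪ Range (Layer M k) N) a b →
  GrayCode (Layer M k (suc N)) c d → Close b c → Disjoint T (Range (Layer M k) (suc N)) →
  GrayCode (T ∪ Range (Layer M k) (suc N)) a d
GrayCode-snocʳ G B b~c T#R =
  GrayCode-≐ ∪-comm (GrayCode-snocˡ (GrayCode-≐ ∪-comm G) B b~c (λ (r , t) → T#R (t , r)))

-- Snakes through consecutive layers

double : ℕ → ℕ
double zero = zero
double (suc n) = suc (suc (double n))

n≤double : ∀ n → n ≤ double n
n≤double zero = z≤n
n≤double (suc n) = s≤s (m≤n⇒m≤1+n (n≤double n))

module Snake {M k : ℕ} {f l : Word} (Z : GrayCode (InZ k) f l) where

  layer : ∀ j → GrayCode (Layer M k j) (lead (M ∸ j) j f) (lead (M ∸ j) j l)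
  layer j = GrayCode-lead (M ∸ j) j Z

  odd : ∀ i → suc (double i) ≤ M →
    GrayCode (Range (Layer M k) (suc (double i)))
      (lead (M ∸ 1) 1 l) (lead (M ∸ suc (double i)) (suc (double i)) f)
  even : ∀ i → double (suc i) ≤ M →
    GrayCode (Range (Layer M k) (double (suc i)))
      (lead (M ∸ 1) 1 l) (lead (M ∸ double (suc i)) (double (suc i)) l)

  odd zero _ = GrayCode-≐ (≐-sym Range-one) (GrayCode-reverse (layer 1))
  odd (suc i) h =
    GrayCode-snoc (even i (<⇒≤ h)) (GrayCode-reverse (layer (suc (double (suc i)))))
      (close-layer-step _ l h)
  even i h = GrayCode-snoc (odd i (<⇒≤ h)) (layer (double (suc i))) (close-layer-step _ f h)

GrayCode-twoRanges : ∀ {R i kA kB fA lA lB} → suc (double i) ≤ R →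
  GrayCode (InZ kA) fA lA → GrayCode (InZ kB) (false ∷ lA) lB →
  GrayCode (Range (Layer (suc R) kA) (double (suc i)) ∪ Range (Layer R kB) (suc (double i)))
    (lead (R ∸ 1) 1 lB) (lead R 1 lA)
GrayCode-twoRanges {R} {i} {lA = lA} h ZA ZB = GrayCode-≐ ∪-comm
  (GrayCode-++ (Snake.odd ZB i h) (GrayCode-reverse (Snake.even ZA i (s≤s h)))
    (close-absorb (R ∸ suc (double i)) (suc (double i)) lA)
    (Range-disjoint (m≢1+n+m R {0}) h (s≤s h)))

module Interleaving {R kC kA : ℕ}
  (ZC : GrayCode (InZ kC) [] [])
  (ZA : GrayCode (InZ kA) (false ∷ []) (false ∷ [])) where

  C A : ℕ → Word → Set
  C = Layer (suc (suc R)) kC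
  A = Layer (suc R) kA

  c a : ℕ → Word
  c j = lead (suc (suc R) ∸ j) j []
  a j = lead (suc R ∸ j) j (false ∷ [])

  layerC : ∀ j → GrayCode (C j) (c j) (c j)
  layerC j = GrayCode-lead (suc (suc R) ∸ j) j ZC

  layerA : ∀ j → GrayCode (A j) (a j) (a j)
  layerA j = GrayCode-lead (suc R ∸ j) j ZA

  A#C : ∀ {N N′} → N ≤ suc R → N′ ≤ suc (suc R) → Disjoint (Range A N) (Range C N′)
  A#C = Range-disjoint (m≢1+n+m (suc R) {0})

  -- c (j+1) → c (j+2) → a (j+1) → a (j+2)
  round : ∀ j → suc (suc j) ≤ R → GrayCode (Range A j ∪ Range C (suc j)) (c 1) (c (suc j)) →
    GrayCode (Range A (suc (suc j)) ∪ Range C (suc (suc j))) (c 1) (a (suc (suc j)))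
  round j 2+j≤R G =
    GrayCode-snocˡ
      (GrayCode-snocˡ
        (GrayCode-snocʳ G (layerC (suc (suc j))) (close-layer-step (suc j) [] 2+j≤2+R)
          (A#C (<⇒≤ (<⇒≤ 2+j≤1+R)) 2+j≤2+R))
        (layerA (suc j)) (close-sym {a (suc j)} {c (suc (suc j))} (close-absorb (R ∸ j) (suc j) []))
        (A#C (<⇒≤ 2+j≤1+R) 2+j≤2+R))
      (layerA (suc (suc j))) (close-layer-step (suc j) (false ∷ []) 2+j≤1+R)
      (A#C 2+j≤1+R 2+j≤2+R)
    where
    2+j≤1+R : suc (suc j) ≤ suc R
    2+j≤1+R = m≤n⇒m≤1+n 2+j≤R
    2+j≤2+R : suc (suc j) ≤ suc (suc R)
    2+j≤2+R = m≤n⇒m≤1+n 2+j≤1+R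

  alternating : ∀ i → double (suc i) ≤ R →
    GrayCode (Range A (double (suc i)) ∪ Range C (double (suc i))) (c 1) (a (double (suc i)))
  alternating zero h = round 0 h (GrayCode-≐ only-c₁ (layerC 1))
    where
    only-c₁ : C 1 ≐ Range A 0 ∪ Range C 1
    only-c₁ = inj₂ ∘ proj₂ (Range-one {C})
            , [ ⊥-elim ∘ Range-zero-empty {A} , proj₁ (Range-one {C}) ]′
  alternating (suc i) h = round (double (suc i)) h
    (GrayCode-snocʳ (alternating i 2i+2≤R) (layerC (suc (double (suc i))))
      (close-absorb (suc R ∸ double (suc i)) (double (suc i)) [])
      (A#C (m≤n⇒m≤1+n 2i+2≤R) (m≤n⇒m≤1+n (m≤n⇒m≤1+n (<⇒≤ h)))))
    where
    2i+2≤R : double (suc i) ≤ R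
    2i+2≤R = <⇒≤ (<⇒≤ h)

GrayCode-threeRanges : ∀ {R i kC kA kB} → double (suc i) ≤ R →
  GrayCode (InZ kC) [] [] → GrayCode (InZ kA) (false ∷ []) (false ∷ []) →
  GrayCode (InZ kB) (false ∷ false ∷ []) (false ∷ false ∷ []) →
  GrayCode (Range (Layer (suc (suc R)) kC) (double (suc i)) ∪
             (Range (Layer (suc R) kA) (double (suc i)) ∪ Range (Layer R kB) (suc (double i))))
    (lead (R ∸ 1) 1 (false ∷ false ∷ [])) (lead (suc R) 1 [])
GrayCode-threeRanges {R} {i} {kB = kB} h ZC ZA ZB = GrayCode-≐ ∪-reverse₃
  (GrayCode-++ (Snake.odd {M = R} ZB i (<⇒≤ h)) (GrayCode-reverse (alternating i h))
    (close-absorb (R ∸ suc (double i)) (suc (double i)) (false ∷ []))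
    (Disjoint-∪ʳ {Range B (suc (double i))}
      (Range-disjoint (m≢1+n+m R {0}) (<⇒≤ h) (m≤n⇒m≤1+n h))
      (Range-disjoint (m≢1+n+m R {1}) (<⇒≤ h) (m≤n⇒m≤1+n (m≤n⇒m≤1+n h)))))
  where
  open Interleaving ZC ZA
  B : ℕ → Word → Set
  B = Layer R kB

-- Arithmetic of r = 4(u + 1) + 1 and the available codes for 𝒵_k

2+-/2 : ∀ n → suc (suc n) / 2 ≡ suc (n / 2)
2+-/2 n = m/n≡1+[m∸n]/n {suc (suc n)} {2} (s≤s (s≤s z≤n))

double-/2 : ∀ n → double n / 2 ≡ n
double-/2 zero = refl
double-/2 (suc n) = trans (2+-/2 (double n)) (cong suc (double-/2 n))

suc-double-/2 : ∀ n → suc (double n) / 2 ≡ n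
suc-double-/2 zero = refl
suc-double-/2 (suc n) = trans (2+-/2 (suc (double n))) (cong suc (suc-double-/2 n))

≡1-mod-4 : ∀ r → r % 4 ≡ 1 → 3 ≤ r → Σ ℕ λ u → r ≡ suc (double (double (suc u)))
≡1-mod-4 r r%4≡1 3≤r with r / 4 | m≡m%n+[m/n]*n r 4
... | zero | r≡ rewrite r%4≡1 = ⊥-elim (n≮0 (≤-pred (subst (3 ≤_) r≡ 3≤r)))
... | suc u | r≡ rewrite r%4≡1 = u , trans r≡ (cong suc (times4 (suc u)))
  where
  times4 : ∀ q → q * 4 ≡ double (double q)
  times4 zero = refl
  times4 (suc q) = cong (suc ∘ suc ∘ suc ∘ suc) (times4 q)

2u+2≤4u+4 : ∀ u → double (suc u) ≤ double (double (suc u))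
2u+2≤4u+4 u = s≤s (s≤s (m≤n⇒m≤1+n (m≤n⇒m≤1+n (n≤double (double u)))))

InD≐Range : ∀ n {r N} → (r ∸ 1) / 2 ≡ N → InD n r ≐ Range (Layer r (n ∸ r)) N
InD≐Range n refl = (λ x → x) , (λ x → x)

emptyCode : GrayCode (InZ 0) [] []
emptyCode = record
  { list = [] ∷ [] ; sound = λ { (here refl) → refl , ε-decreasing , inj₁ refl }
  ; complete = λ { {[]} _ → here refl } ; unique = [] ∷ [] ; linked = [-]
  ; starts = refl ; ends = refl }
  where
  ε-decreasing : OneDecreasing []
  ε-decreasing [] zero _ _ _ ()
  ε-decreasing [] (suc _) _ _ () _ _ _
  ε-decreasing (_ ∷ _) _ _ _ () _ _ _

module ZCodes {n} (codes : ZCodesBelow n) where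

  code : ∀ {k} → 1 ≤ k → k < n →
    GrayCode (InZ k) (false ∷ star w001 (k ∸ 1)) (star w001 k)
  code 1≤k k<n = let (_ , isGray , h , t) = codes _ 1≤k k<n in fromIsGrayCode isGray h t

  codeEndingInStar : ∀ k → k < n → Σ Word λ f → GrayCode (InZ k) f (star w001 k)
  codeEndingInStar zero _ = [] , emptyCode
  codeEndingInStar (suc k) k<n = _ , code (s≤s z≤n) k<n

case-i : ∀ {n} u → let R = double (double (suc u)) in suc R ≤ n → ZCodesBelow n →
  GrayCode (InD n (suc R) ∪ InD n R)
    (lead (R ∸ 1) 1 (star w001 (n ∸ R))) (lead R 1 (star w001 (n ∸ suc R)))
case-i {n} u r≤n codes =
  GrayCode-≐ (∪-cong (≐-sym (InD≐Range n (double-/2 (double (suc u)))))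
                     (≐-sym (InD≐Range n (suc-double-/2 (suc (double u))))))
    (GrayCode-twoRanges (<⇒≤ (2u+2≤4u+4 u)) (proj₂ ZA) ZB)
  where
  open ZCodes codes
  R r : ℕ
  R = double (double (suc u))
  r = suc R
  ZA : Σ Word λ f → GrayCode (InZ (n ∸ r)) f (star w001 (n ∸ r))
  ZA = codeEndingInStar (n ∸ r) (∸-monoʳ-< (s≤s z≤n) r≤n)
  ZB : GrayCode (InZ (n ∸ R)) (false ∷ star w001 (n ∸ r)) (star w001 (n ∸ R))
  ZB = subst (λ k → GrayCode (InZ k) (false ∷ star w001 (n ∸ r)) (star w001 k))
         (sym (∸≡suc∸suc r≤n))
         (code (s≤s z≤n) (subst (_< n) (∸≡suc∸suc r≤n) (∸-monoʳ-< (s≤s z≤n) (<⇒≤ r≤n))))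

case-ii : ∀ {n} u → let R = double (double (suc u)) in suc (suc R) ≡ n → ZCodesBelow n →
  GrayCode (InD n n ∪ (InD n (n ∸ 1) ∪ InD n (n ∸ 2)))
    (0^ (n ∸ 3) ++ true ∷ false ∷ false ∷ []) (0^ (n ∸ 1) ++ true ∷ [])
case-ii u refl codes =
  GrayCode-≐ (∪-cong (≐-sym (InD≐Range n (suc-double-/2 (double (suc u)))))
               (∪-cong (≐-sym (InD≐Range n (double-/2 (double (suc u)))))
                       (≐-sym (InD≐Range n (suc-double-/2 (suc (double u)))))))
    (GrayCode-threeRanges (2u+2≤4u+4 u) Z₀ Z₁ Z₂)
  where
  open ZCodes codes
  R n : ℕ
  R = double (double (suc u))
  n = suc (suc R)
  Z₀ : GrayCode (InZ (n ∸ n)) [] []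
  Z₀ = subst (λ k → GrayCode (InZ k) [] []) (sym (n∸n≡0 n)) emptyCode
  Z₁ : GrayCode (InZ (n ∸ suc R)) (false ∷ []) (false ∷ [])
  Z₁ = subst (λ k → GrayCode (InZ k) (false ∷ []) (false ∷ [])) (sym (m+n∸n≡m 1 (suc R)))
         (code (s≤s z≤n) (s≤s (s≤s z≤n)))
  Z₂ : GrayCode (InZ (n ∸ R)) (false ∷ false ∷ []) (false ∷ false ∷ [])
  Z₂ = subst (λ k → GrayCode (InZ k) (false ∷ false ∷ []) (false ∷ false ∷ [])) (sym (m+n∸n≡m 2 R))
         (code (s≤s z≤n) (s≤s (s≤s (s≤s z≤n))))

lemma4 : (n r : ℕ) → r % 4 ≡ 1 → 3 ≤ r → r ≤ n → ZCodesBelow n →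
    ((r + 1 ≢ n →
      Σ (List Word) λ Δ → IsGrayCode (λ w → InD n r w ⊎ InD n (r ∸ 1) w) Δ ×
        (head Δ ≡ just (0^ (r ∸ 2) ++ true ∷ star w001 (n ∸ (r ∸ 1)))) ×
        (last Δ ≡ just (0^ (r ∸ 1) ++ true ∷ star w001 (n ∸ r))))
    × (r + 1 ≡ n →
      Σ (List Word) λ Δ →
        IsGrayCode (λ w → InD n n w ⊎ (InD n (n ∸ 1) w ⊎ InD n (n ∸ 2) w)) Δ ×
        (head Δ ≡ just (0^ (n ∸ 3) ++ true ∷ false ∷ false ∷ [])) ×
        (last Δ ≡ just (0^ (n ∸ 1) ++ true ∷ []))))
lemma4 n r r%4≡1 3≤r r≤n codes with ≡1-mod-4 r r%4≡1 3≤r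
... | u , refl =
  -- The construction for (i) does not need r + 1 ≢ n.
  (λ _ → toIsGrayCode (case-i u r≤n codes)) ,
  (λ r+1≡n → toIsGrayCode (case-ii u (trans (+-comm 1 r) r+1≡n) codes))
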